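{- Let $G=(B,S,E)$ be a bipartite graph with buyer set $B$ and good set $S$, $|B|=|S|=n$, and number the buyers $1,\dots,n$ in their (fixed) order of arrival. Fix pairwise distinct prices $p_k\in[1/e,1]$ for the goods $k\in S$, and fix a good $j\in S$. Let $F_1=\{k\in S: p_k<p_j\}$ and $F_2=\{k\in S: p_k>p_j\}$. Let $S(i)$ (resp. $S_j(i)$) be the set of goods adjacent to buyer $i$ in $G$ (resp. in $G_j$) that are still unmatched just before buyer $i$ is processed in run $\mathcal{R}$ (resp. run $\mathcal{R}_j$). Then for each $i$, $1\le i\le n$: (1) $S_j(i)\cap F_1 = S(i)\cap F_1$; (2) $S_j(i)\cap F_2\subseteq S(i)\cap F_2$; (3) $S_j(i)\subseteq S(i)$.
   Context: Online bipartite matching setting: buyers arrive one at a time in a fixed order; when buyer $i$ arrives, her neighbors in $G$ are revealed. Run $\mathcal{R}$: process the buyers of $G$ in arrival order, matching each arriving buyer to the cheapest (smallest price) still-unmatched good adjacent to her in $G$, leaving her unmatched if there is none. $G_j$ denotes $G$ with good $j$ removed, and run $\mathcal{R}_j$ is the same procedure, with the same prices and same arrival order, executed on $G_j$. -}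

module Defs where

open import Level using (Level)
open import Data.Bool using (Bool; true; false; if_then_else_)
open import Data.Nat as ℕ using (ℕ; zero; suc)
open import Data.Fin using (Fin; toℕ; fromℕ<)
open import Data.Fin.Subset using (Subset; _∩_; _∪_; ∁; ⁅_⁆; _∈_)
open import Data.Fin.Subset.Properties using (_∈?_)
open import Data.List using (foldr; allFin)
open import Data.Maybe using (Maybe; just; nothing)
open import Data.Vec using (tabulate)
open import Relation.Nullary using (yes; no)
open import Relation.Nullary.Decidable using (⌊_⌋)
open import Relation.Binary.Bundles using (StrictTotalOrder)

-- Prices take values in an arbitrary strict total order O
-- (the paper uses reals in [1/e,1]; only the order matters).
-- A bipartite graph with n buyers and n goods (both Fin n) is given by the
-- neighbourhood  N i : Subset n  of each buyer i (buyers arrive in order 0,1,…,n-1).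

module _ {a ℓ₁ ℓ₂ : Level} (O : StrictTotalOrder a ℓ₁ ℓ₂) where
  open StrictTotalOrder O renaming (Carrier to Price)

  cheapest : ∀ {n} → (Fin n → Price) → Subset n → Maybe (Fin n)
  cheapest {n} p s = foldr step nothing (allFin n)
    where
    step : Fin n → Maybe (Fin n) → Maybe (Fin n)
    step k best with k ∈? s
    ... | no _ = best
    ... | yes _ with best
    ...   | nothing = just k
    ...   | just b  = if ⌊ p k <? p b ⌋ then just k else just b

  runStep : ∀ {n} → (Fin n → Price) → (Fin n → Subset n) → ℕ → Subset n → Subset n
  runStep {n} p N t matched with t ℕ.<? n
  ... | no _ = matched
  ... | yes t<n with cheapest p (N (fromℕ< t<n) ∩ ∁ matched)
  ...   | nothing = matched
  ...   | just k  = matched ∪ ⁅ k ⁆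

  matchedAfter : ∀ {n} → (Fin n → Price) → (Fin n → Subset n) → ℕ → Subset n
  matchedAfter p N zero    = Data.Fin.Subset.⊥
  matchedAfter p N (suc t) = runStep p N t (matchedAfter p N t)

  available : ∀ {n} → (Fin n → Price) → (Fin n → Subset n) → Fin n → Subset n
  available p N i = N i ∩ ∁ (matchedAfter p N (toℕ i))

  cheaperThan : ∀ {n} → (Fin n → Price) → Fin n → Subset n
  cheaperThan p j = tabulate λ k → ⌊ p k <? p j ⌋

  dearerThan : ∀ {n} → (Fin n → Price) → Fin n → Subset n
  dearerThan p j = tabulate λ k → ⌊ p j <? p k ⌋

removeGood : ∀ {n} → (Fin n → Subset n) → Fin n → (Fin n → Subset n)
removeGood N j i = N i ∩ ∁ ⁅ j ⁆

{-# OPTIONS --safe #-}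
module Submission where

-- At every moment the run on G_j is shadowed by the run on G: every good
-- matched in R other than j is also matched in R_j, and every good matched
-- in R_j but not in R is dearer than j. This is preserved by each greedy step:
-- if R takes a good c that R_j can still take, R_j takes c as well; otherwise
-- c is j or a good dearer than j, and whatever R_j takes instead is dearer than
-- c. Hence R_j sees a subset of what R sees, and exactly the same goods
-- cheaper than j.

open import Defs
open import Data.Nat using (ℕ)
open import Data.Fin using (Fin)
open import Data.Fin.Subset using (Subset; _∩_; _⊆_)
open import Data.Product using (_×_)
open import Relation.Binary.PropositionalEquality using (_≡_)
open import Relation.Binary.Bundles using (StrictTotalOrder)

open import Level using (0ℓ)
open import Data.Nat as ℕ using (zero; suc) renaming (_<_ to _<ℕ_)
open import Data.Nat.Properties using (<-irrelevant)
open import Data.Fin using (toℕ; fromℕ<; _≟_)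
open import Data.Fin.Subset using (_∪_; ∁; ⁅_⁆; _∈_; _∉_)
open import Data.Fin.Subset.Properties
open import Data.List using (List; []; _∷_; foldr; allFin)
open import Data.List.Membership.Propositional using () renaming (_∈_ to _∈ₗ_)
open import Data.List.Membership.Propositional.Properties using (∈-allFin)
open import Data.List.Relation.Unary.Any using (here; there)
open import Data.Maybe using (Maybe; nothing; just)
open import Data.Maybe.Properties using (just-injective)
open import Data.Empty using (⊥-elim)
open import Data.Sum using (_⊎_; inj₁; inj₂)
open import Data.Product using (_,_; proj₁; proj₂)
open import Data.Bool.Properties using (T-≡)
open import Data.Vec.Properties using (lookup∘tabulate; []=⇒lookup)
open import Function.Bundles using (Equivalence)
open import Relation.Nullary using (¬_; Dec; yes; no)
open import Relation.Nullary.Decidable using (toWitness; ⌊_⌋)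
open import Relation.Unary using (Pred)
open import Relation.Binary using (tri<; tri≈; tri>)
open import Relation.Binary.PropositionalEquality using (refl; sym; trans; subst₂; _≢_)

∩-monoˡ-⊆ : ∀ {n} {p q : Subset n} (r : Subset n) → p ⊆ q → p ∩ r ⊆ q ∩ r
∩-monoˡ-⊆ {p = p} r p⊆q x∈ with x∈p∩q⁻ p r x∈
... | x∈p , x∈r = x∈p∩q⁺ (p⊆q x∈p , x∈r)

addGood : ∀ {n} → Subset n → Maybe (Fin n) → Subset n
addGood M nothing  = M
addGood M (just k) = M ∪ ⁅ k ⁆

⊆-addGood : ∀ {n} (M : Subset n) r → M ⊆ addGood M r
⊆-addGood M nothing  = λ k∈ → k∈
⊆-addGood M (just k) = p⊆p∪q ⁅ k ⁆

module Greedy {a ℓ₁ ℓ₂} (O : StrictTotalOrder a ℓ₁ ℓ₂) {n : ℕ}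
  (p : Fin n → StrictTotalOrder.Carrier O) where
  open StrictTotalOrder O using (_≈_; _<_; _<?_; compare; irrefl; module Eq)
    renaming (trans to <-trans)

  data Cheapest (P : Pred (Fin n) 0ℓ) : Maybe (Fin n) → Set ℓ₂ where
    none : (∀ k → ¬ P k) → Cheapest P nothing
    some : ∀ {c} → P c → (∀ {k} → P k → ¬ p k < p c) → Cheapest P (just c)

  Cheapest-resp : ∀ {P Q r} → (∀ {k} → P k → Q k) → (∀ {k} → Q k → P k)
    → Cheapest P r → Cheapest Q r
  Cheapest-resp P⇒Q Q⇒P (none ¬P)      = none λ k q → ¬P k (Q⇒P q)
  Cheapest-resp P⇒Q Q⇒P (some c∈ cmin) = some (P⇒Q c∈) λ q → cmin (Q⇒P q)

  -- The local step function of cheapest, extracted by unifying its body with foldr f nothing.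
  cheapest-step : Subset n → Fin n → Maybe (Fin n) → Maybe (Fin n)
  cheapest-step s = step-of refl
    where
    step-of : ∀ {f} → cheapest O p s ≡ foldr f nothing (allFin n)
      → Fin n → Maybe (Fin n) → Maybe (Fin n)
    step-of {f} _ = f

  ListedIn : List (Fin n) → Subset n → Pred (Fin n) 0ℓ
  ListedIn l s k = k ∈ₗ l × k ∈ s

  foldr-cheapest-step : ∀ s l → Cheapest (ListedIn l s) (foldr (cheapest-step s) nothing l)
  foldr-cheapest-step s []      = none λ { k (() , _) }
  foldr-cheapest-step s (k ∷ l) = step (foldr-cheapest-step s l)
    where
    step : ∀ {b} → Cheapest (ListedIn l s) b → Cheapest (ListedIn (k ∷ l) s) (cheapest-step s k b)
    step spec with k ∈? s
    step (none ¬l) | no k∉s =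
      none λ { _ (here refl , k∈s) → k∉s k∈s ; k' (there m , k'∈s) → ¬l k' (m , k'∈s) }
    step (some (c∈l , c∈s) cmin) | no k∉s =
      some (there c∈l , c∈s)
        λ { (here refl , k∈s) → ⊥-elim (k∉s k∈s) ; (there m , k'∈s) → cmin (m , k'∈s) }
    step (none ¬l) | yes k∈s =
      some (here refl , k∈s)
        λ { (here refl , _) → irrefl Eq.refl ; {k'} (there m , k'∈s) → ⊥-elim (¬l k' (m , k'∈s)) }
    step (some {c} (c∈l , c∈s) cmin) | yes k∈s with p k <? p c
    ... | yes k<c = some (here refl , k∈s)
          λ { (here refl , _) → irrefl Eq.refl
            ; (there m , k'∈s) k'<k → cmin (m , k'∈s) (<-trans k'<k k<c) }
    ... | no k≮c = some (there c∈l , c∈s)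
          λ { (here refl , _) → k≮c ; (there m , k'∈s) → cmin (m , k'∈s) }

  cheapest-spec : ∀ s → Cheapest (_∈ s) (cheapest O p s)
  cheapest-spec s =
    Cheapest-resp proj₂ (λ k∈s → ∈-allFin _ , k∈s) (foldr-cheapest-step s (allFin n))

  runStep-< : ∀ N t M (t<n : t <ℕ n)
    → runStep O p N t M ≡ addGood M (cheapest O p (N (fromℕ< t<n) ∩ ∁ M))
  runStep-< N t M t<n with t ℕ.<? n
  ... | no t≮n = ⊥-elim (t≮n t<n)
  ... | yes t<n′ rewrite <-irrelevant t<n t<n′ with cheapest O p (N (fromℕ< t<n′) ∩ ∁ M)
  ...   | nothing = refl
  ...   | just k  = refl

  runStep-≮ : ∀ N t M → ¬ t <ℕ n → runStep O p N t M ≡ M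
  runStep-≮ N t M t≮n with t ℕ.<? n
  ... | no _    = refl
  ... | yes t<n = ⊥-elim (t≮n t<n)

  ∈-cheaperThan⁻ : ∀ {j k} → k ∈ cheaperThan O p j → p k < p j
  ∈-cheaperThan⁻ {j} {k} k∈ =
    toWitness (Equivalence.from T-≡
      (trans (sym (lookup∘tabulate (λ k → ⌊ p k <? p j ⌋) k)) ([]=⇒lookup k∈)))

  module _ (p-injective : ∀ k l → p k ≈ p l → k ≡ l) where

    Cheapest-< : ∀ {P c k} → Cheapest P (just c) → P k → k ≢ c → p c < p k
    Cheapest-< {c = c} {k} (some _ cmin) k∈ k≢c with compare (p c) (p k)
    ... | tri< c<k _ _ = c<k
    ... | tri≈ _ c≈k _ = ⊥-elim (k≢c (sym (p-injective c k c≈k)))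
    ... | tri> _ _ k<c = ⊥-elim (cmin k∈ k<c)

    Cheapest-forced : ∀ {P Q c r} → Cheapest P (just c) → (∀ {k} → Q k → P k) → Q c
      → Cheapest Q r → r ≡ just c
    Cheapest-forced spec Q⇒P c∈Q (none ¬Q) = ⊥-elim (¬Q _ c∈Q)
    Cheapest-forced {c = c} spec Q⇒P c∈Q (some {c'} c'∈Q c'min) with c' ≟ c
    ... | yes refl = refl
    ... | no c'≢c  = ⊥-elim (c'min c∈Q (Cheapest-< spec (Q⇒P c'∈Q) c'≢c))

module Removal {a ℓ₁ ℓ₂} (O : StrictTotalOrder a ℓ₁ ℓ₂) {n : ℕ}
  (p : Fin n → StrictTotalOrder.Carrier O)
  (p-injective : ∀ k l → StrictTotalOrder._≈_ O (p k) (p l) → k ≡ l)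
  (j : Fin n) where
  open StrictTotalOrder O using (_<_; irrefl; asym; module Eq) renaming (trans to <-trans)
  open Greedy O p

  record Shadows (M M' : Subset n) : Set ℓ₂ where
    field
      kept         : ∀ {k} → k ∈ M → k ≢ j → k ∈ M'
      extra-dearer : ∀ {k} → k ∈ M' → k ∉ M → p j < p k
  open Shadows

  shadows-⊥ : Shadows Data.Fin.Subset.⊥ Data.Fin.Subset.⊥
  shadows-⊥ = record
    { kept         = λ k∈ _ → ⊥-elim (∉⊥ k∈)
    ; extra-dearer = λ k∈ _ → ⊥-elim (∉⊥ k∈)
    }

  available-⊆ : ∀ {M M'} → Shadows M M' → (B : Subset n) → (B ∩ ∁ ⁅ j ⁆) ∩ ∁ M' ⊆ B ∩ ∁ M
  available-⊆ {M} {M'} sh B k∈ with x∈p∩q⁻ (B ∩ ∁ ⁅ j ⁆) (∁ M') k∈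
  ... | k∈B-j , k∉M' with x∈p∩q⁻ B (∁ ⁅ j ⁆) k∈B-j
  ...   | k∈B , k∉j =
    x∈p∩q⁺ (k∈B , x∉p⇒x∈∁p λ k∈M →
      x∈∁p⇒x∉p k∉M' (kept sh k∈M (x∉⁅y⁆⇒x≢y (x∈∁p⇒x∉p k∉j))))

  available-cheaper : ∀ {M M'} → Shadows M M' → (B : Subset n) → ∀ {k}
    → k ∈ B ∩ ∁ M → p k < p j → k ∈ (B ∩ ∁ ⁅ j ⁆) ∩ ∁ M'
  available-cheaper {M} {M'} sh B {k} k∈ k<j with x∈p∩q⁻ B (∁ M) k∈
  ... | k∈B , k∉M =
    x∈p∩q⁺ (x∈p∩q⁺ (k∈B , x∉p⇒x∈∁p (x≢y⇒x∉⁅y⁆ k≢j)) ,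
            x∉p⇒x∈∁p λ k∈M' → asym k<j (extra-dearer sh k∈M' (x∈∁p⇒x∉p k∉M)))
    where
    k≢j : k ≢ j
    k≢j refl = irrefl Eq.refl k<j

  shadows-step : ∀ {M M' r r'} (B : Subset n) → Shadows M M'
    → Cheapest (_∈ B ∩ ∁ M) r → Cheapest (_∈ (B ∩ ∁ ⁅ j ⁆) ∩ ∁ M') r'
    → Shadows (addGood M r) (addGood M' r')
  shadows-step B sh (none _) (none _) = sh
  shadows-step B sh (none ¬A) (some c'∈ _) = ⊥-elim (¬A _ (available-⊆ sh B c'∈))
  shadows-step {M} {M'} {just c} {r'} B sh spec@(some c∈A _) spec' =
    record { kept = kept' ; extra-dearer = extra-dearer' spec' }
    where
    c∉M : c ∉ M
    c∉M = x∈∁p⇒x∉p (proj₂ (x∈p∩q⁻ B (∁ M) c∈A))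

    taken-by-R_j : ∀ {r''} → Cheapest (_∈ (B ∩ ∁ ⁅ j ⁆) ∩ ∁ M') r''
      → c ∈ (B ∩ ∁ ⁅ j ⁆) ∩ ∁ M' → r'' ≡ just c
    taken-by-R_j spec'' c∈A' = Cheapest-forced p-injective spec (available-⊆ sh B) c∈A' spec''

    c-fate : c ≡ j ⊎ c ∈ M' ⊎ c ∈ (B ∩ ∁ ⁅ j ⁆) ∩ ∁ M'
    c-fate with c ≟ j | c ∈? M'
    ... | yes c≡j | _       = inj₁ c≡j
    ... | no _    | yes c∈M' = inj₂ (inj₁ c∈M')
    ... | no c≢j  | no c∉M' =
      inj₂ (inj₂ (x∈p∩q⁺ (x∈p∩q⁺ (proj₁ (x∈p∩q⁻ B (∁ M) c∈A) , x∉p⇒x∈∁p (x≢y⇒x∉⁅y⁆ c≢j)) ,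
                          x∉p⇒x∈∁p c∉M')))

    kept' : ∀ {k} → k ∈ M ∪ ⁅ c ⁆ → k ≢ j → k ∈ addGood M' r'
    kept' k∈ k≢j with x∈p∪q⁻ M ⁅ c ⁆ k∈
    ... | inj₁ k∈M = ⊆-addGood M' r' (kept sh k∈M k≢j)
    ... | inj₂ k∈c with x∈⁅y⁆⇒x≡y c k∈c
    ...   | refl with c-fate
    ...     | inj₁ c≡j = ⊥-elim (k≢j c≡j)
    ...     | inj₂ (inj₁ c∈M') = ⊆-addGood M' r' c∈M'
    ...     | inj₂ (inj₂ c∈A') rewrite taken-by-R_j spec' c∈A' = x∈p∪q⁺ (inj₂ (x∈⁅x⁆ c))

    replacement-dearer : ∀ {c'} → Cheapest (_∈ (B ∩ ∁ ⁅ j ⁆) ∩ ∁ M') (just c')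
      → c' ≢ c → p j < p c'
    replacement-dearer spec''@(some c'∈A' _) c'≢c with c-fate
    ... | inj₁ refl = Cheapest-< p-injective spec (available-⊆ sh B c'∈A') c'≢c
    ... | inj₂ (inj₁ c∈M') =
      <-trans (extra-dearer sh c∈M' c∉M) (Cheapest-< p-injective spec (available-⊆ sh B c'∈A') c'≢c)
    ... | inj₂ (inj₂ c∈A') = ⊥-elim (c'≢c (just-injective (taken-by-R_j spec'' c∈A')))

    extra-dearer' : ∀ {r'' k} → Cheapest (_∈ (B ∩ ∁ ⁅ j ⁆) ∩ ∁ M') r''
      → k ∈ addGood M' r'' → k ∉ M ∪ ⁅ c ⁆ → p j < p k
    extra-dearer' (none _) k∈M' k∉ = extra-dearer sh k∈M' (λ k∈M → k∉ (p⊆p∪q ⁅ c ⁆ k∈M))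
    extra-dearer' spec''@(some {c'} _ _) k∈ k∉ with x∈p∪q⁻ M' ⁅ c' ⁆ k∈
    ... | inj₁ k∈M' = extra-dearer sh k∈M' (λ k∈M → k∉ (p⊆p∪q ⁅ c ⁆ k∈M))
    ... | inj₂ k∈c' with x∈⁅y⁆⇒x≡y c' k∈c'
    ...   | refl = replacement-dearer spec'' λ { refl → k∉ (q⊆p∪q M ⁅ c ⁆ (x∈⁅x⁆ c)) }

  shadows-runStep : ∀ N t {M M'} → Shadows M M'
    → Shadows (runStep O p N t M) (runStep O p (removeGood N j) t M')
  shadows-runStep N t {M} {M'} sh = by-cases (t ℕ.<? n)
    where
    by-cases : Dec (t <ℕ n) → Shadows (runStep O p N t M) (runStep O p (removeGood N j) t M')
    by-cases (no t≮n) =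
      subst₂ Shadows (sym (runStep-≮ N t M t≮n)) (sym (runStep-≮ (removeGood N j) t M' t≮n)) sh
    by-cases (yes t<n) =
      subst₂ Shadows (sym (runStep-< N t M t<n)) (sym (runStep-< (removeGood N j) t M' t<n))
        (shadows-step (N (fromℕ< t<n)) sh (cheapest-spec _) (cheapest-spec _))

  shadows-matchedAfter : ∀ N t
    → Shadows (matchedAfter O p N t) (matchedAfter O p (removeGood N j) t)
  shadows-matchedAfter N zero    = shadows-⊥
  shadows-matchedAfter N (suc t) = shadows-runStep N t (shadows-matchedAfter N t)

corollary3p3 : ∀ {a ℓ₁ ℓ₂} (O : StrictTotalOrder a ℓ₁ ℓ₂) (n : ℕ)
    (N : Fin n → Subset n) (p : Fin n → StrictTotalOrder.Carrier O)
    → (∀ k l → StrictTotalOrder._≈_ O (p k) (p l) → k ≡ l)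
    → (j : Fin n) → (i : Fin n)
    → (available O p (removeGood N j) i ∩ cheaperThan O p j ≡ available O p N i ∩ cheaperThan O p j)
      × (available O p (removeGood N j) i ∩ dearerThan O p j ⊆ available O p N i ∩ dearerThan O p j)
      × (available O p (removeGood N j) i ⊆ available O p N i)
corollary3p3 O n N p p-injective j i =
  ⊆-antisym (∩-monoˡ-⊆ (cheaperThan O p j) available-shrinks) cheaper-survive ,
  ∩-monoˡ-⊆ (dearerThan O p j) available-shrinks ,
  available-shrinks
  where
  open Greedy O p using (∈-cheaperThan⁻)
  open Removal O p p-injective j
  shadows : Shadows (matchedAfter O p N (toℕ i)) (matchedAfter O p (removeGood N j) (toℕ i))
  shadows = shadows-matchedAfter N (toℕ i)


  available-shrinks : available O p (removeGood N j) i ⊆ available O p N i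
  available-shrinks = available-⊆ shadows (N i)

  cheaper-survive : available O p N i ∩ cheaperThan O p j
                  ⊆ available O p (removeGood N j) i ∩ cheaperThan O p j
  cheaper-survive k∈ with x∈p∩q⁻ (available O p N i) (cheaperThan O p j) k∈
  ... | k∈A , k<j = x∈p∩q⁺ (available-cheaper shadows (N i) k∈A (∈-cheaperThan⁻ k<j) , k<j)
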